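{- Let $k \ge 2$ be an integer and let $\beta_{2,1} = 1.08239\ldots$ be the smallest positive real root of $y^4 - 8y^2 + 8 = 0$ (equivalently $\beta_{2,1} = \sqrt{4-2\sqrt{2}}$). Then $Q_1(2,k) > \beta_{2,1}^k$.
   Context: For positive integers $k$ and $n$, a $k$-term quasi-progression of diameter $n$ is a sequence of integers $(a_1,a_2,\ldots,a_k)$ such that for some positive integer $d$ (the low difference), $d \le a_{j+1}-a_j \le d+n$ for every $1 \le j \le k-1$. For positive integers $r$, $n$, $k$, $Q_n(r,k)$ denotes the least positive integer $N$ such that every $r$-coloring of $\{1,2,\ldots,N\}$ contains a monochromatic $k$-term quasi-progression of diameter $n$. -}

module Defs where

open import Data.Nat using (ℕ; zero; suc; _+_; _*_; _∸_; _≤_; _<_)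
open import Data.Fin using (Fin)
open import Data.Product using (Σ; _×_; _,_; proj₁; proj₂)
open import Data.Sum using (_⊎_)
open import Relation.Nullary using (¬_)
open import Relation.Binary.PropositionalEquality using (_≡_)

-- The sequence is a : ℕ → ℕ, of which only the
-- entries a 0, …, a (k-1) matter (0-indexed version of (a_1,…,a_k)).
-- d is the low difference: d ≤ a (j+1) - a j ≤ d + n.
MonoQP : {r : ℕ} (n k N : ℕ) (c : ℕ → Fin r) → Set
MonoQP n k N c =
  Σ (ℕ → ℕ) λ a → Σ ℕ λ d →
    (1 ≤ d)
    × (∀ j → j < k → 1 ≤ a j × a j ≤ N)
    × (∀ j → suc j < k → (a j + d ≤ a (suc j)) × (a (suc j) ≤ a j + d + n))
    × (∀ i j → i < k → j < k → c (a i) ≡ c (a j))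

-- Every r-colouring of {1,…,N} contains a monochromatic k-term
-- quasi-progression of diameter n.  (An r-colouring of {1,…,N} is given as
-- any map ℕ → Fin r; only its values on {1,…,N} are used.)
QPProperty : (n r k N : ℕ) → Set
QPProperty n r k N = (c : ℕ → Fin r) → MonoQP n k N c

IsQ : (n r k N : ℕ) → Set
IsQ n r k N =
  (1 ≤ N) × QPProperty n r k N × (∀ M → 1 ≤ M → M < N → ¬ QPProperty n r k M)

-- (4 - 2√2)^k = betaSqPow k .proj₁ - betaSqPow k .proj₂ * √2
-- (recursion: (a - b√2)(4 - 2√2) = (4a + 4b) - (2a + 4b)√2).
betaSqPow : ℕ → ℕ × ℕ
betaSqPow zero = 1 , 0
betaSqPow (suc k) with betaSqPow k
... | a , b = 4 * a + 4 * b , 2 * a + 4 * b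

-- β^k < N, where β = √(4 - 2√2), i.e. (4 - 2√2)^k < N², i.e.
-- a - b√2 < N² with (a,b) = betaSqPow k. With M = N², this holds iff
-- a < M, or (a - M ≥ 0 and) (a - M)² < 2b².
BetaPowLt : ℕ → ℕ → Set
BetaPowLt k N =
  let a = proj₁ (betaSqPow k)
      b = proj₂ (betaSqPow k)
      M = N * N
  in (a < M) ⊎ ((a ∸ M) * (a ∸ M) < 2 * (b * b))

-- Potential argument in the style of Erdős–Selfridge. A frame is a first term a ≤ N, a low difference
-- d ≤ (N − 1)/K and a colour. In a frame, let S_j be the set of last terms of monochromatic (j+1)-term
-- quasi-progressions of diameter 1; S_(j+1) lies in (S_j + d) ∪ (S_j + d + 1), so in a random colouring
-- a point of S_j is worth, in expectation, μ/4 = (2 + √2)/4 = 1/β² points of S_(j+1) once points are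
-- weighted 1 and runs of S_j a further √2. Summing 4^j μ^(K−j) (four times the weight of S_j minus μ times
-- the weight already passed on from S_(j−1)) over levels and frames gives a potential whose mean does not
-- increase when the next point is coloured. If every colouring of 1, …, N had a monochromatic (K+1)-term
-- quasi-progression, the final potential would always be at least 4^K (4 + 4√2), hence so would the
-- initial one, N D μ^K (4 + 4√2); comparing coefficients of √2 gives 4^K ≤ N D (P + Q) with P + Q√2 = μ^K.
-- As K D < N and (4 − 2√2)^(K+1) (P + Q) < 2·4^K, this contradicts N² ≤ β^(2(K+1)).

module Submission where

open import Defs
open import Data.Nat using (ℕ; zero; suc; pred; _+_; _*_; _∸_; _^_; _≤_; _<_; z≤n; s≤s; _≟_; _≤?_; _<?_; NonZero; >-nonZero)
open import Data.Nat.Properties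
open import Data.Nat.DivMod using (_/_; m/n*n≤m; m/n≤m; m*n/n≡m; /-monoˡ-≤)
open import Data.Nat.Tactic.RingSolver using (solve-∀)
open import Data.Bool using (Bool; true; false; _∧_; _∨_; if_then_else_)
open import Data.Bool.Properties using (∧-zeroʳ; ∨-zeroʳ)
open import Data.Fin using (Fin) renaming (zero to fzero; suc to fsuc; _≟_ to _≟ᶠ_)
open import Data.Product using (_×_; _,_; proj₁; proj₂; ∃-syntax)
open import Data.Sum using (_⊎_; inj₁; inj₂)
open import Data.Empty using (⊥; ⊥-elim)
open import Relation.Nullary using (¬_; Dec; yes; no; does)
open import Relation.Nullary.Decidable using (True; toWitness; dec-true; dec-false)
open import Relation.Binary.Definitions using (tri<; tri≈; tri>)
open import Relation.Binary.PropositionalEquality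

Colouring : Set
Colouring = ℕ → Fin 2

pattern red = fzero
pattern blue = fsuc fzero

_[_≔_] : Colouring → ℕ → Fin 2 → Colouring
(c [ x ≔ b ]) z = if does (z ≟ x) then b else c z

AgreeBelow : ℕ → Colouring → Colouring → Set
AgreeBelow n c c′ = ∀ z → z < n → c z ≡ c′ z

AgreeBelow-mono : ∀ {m n c c′} → m ≤ n → AgreeBelow n c c′ → AgreeBelow m c c′
AgreeBelow-mono m≤n agree z z<m = agree z (<-≤-trans z<m m≤n)

[≔]-at : ∀ c x b → (c [ x ≔ b ]) x ≡ b
[≔]-at c x b rewrite dec-true (x ≟ x) refl = refl

[≔]-below : ∀ c x b → AgreeBelow x (c [ x ≔ b ]) c
[≔]-below c x b z z<x rewrite dec-false (z ≟ x) (<⇒≢ z<x) = refl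

-- ⟨ p , q ⟩ stands for p + q√2. Comparing coefficientwise is stronger than comparing the reals.
record ℕ[√2] : Set where
  constructor ⟨_,_⟩
  field
    re im : ℕ
open ℕ[√2]

infixl 6 _⊕_
infixl 7 _⊗_
infix 4 _≼_ _≼?_

_⊕_ : ℕ[√2] → ℕ[√2] → ℕ[√2]
x ⊕ y = ⟨ re x + re y , im x + im y ⟩

_⊗_ : ℕ[√2] → ℕ[√2] → ℕ[√2]
x ⊗ y = ⟨ re x * re y + 2 * (im x * im y) , re x * im y + im x * re y ⟩

double : ℕ[√2] → ℕ[√2]
double x = x ⊕ x

quadruple : ℕ[√2] → ℕ[√2]
quadruple x = ⟨ 4 * re x , 4 * im x ⟩

𝟎 : ℕ[√2]
𝟎 = ⟨ 0 , 0 ⟩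

μ : ℕ[√2]
μ = ⟨ 2 , 1 ⟩

μ^ : ℕ → ℕ[√2]
μ^ zero = ⟨ 1 , 0 ⟩
μ^ (suc n) = μ ⊗ μ^ n

record _≼_ (x y : ℕ[√2]) : Set where
  constructor _,_
  field
    re-≤ : re x ≤ re y
    im-≤ : im x ≤ im y

_≼?_ : ∀ x y → Dec (x ≼ y)
x ≼? y with re x ≤? re y | im x ≤? im y
... | yes p | yes q = yes (p , q)
... | no ¬p | _ = no (λ h → ¬p (_≼_.re-≤ h))
... | _ | no ¬q = no (λ h → ¬q (_≼_.im-≤ h))

≼-by-computation : ∀ {x y} {_ : True (x ≼? y)} → x ≼ y
≼-by-computation {_} {_} {p} = toWitness p

ℕ[√2]-ext : ∀ {x y} → re x ≡ re y → im x ≡ im y → x ≡ y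
ℕ[√2]-ext = cong₂ ⟨_,_⟩

≼-refl : ∀ {x} → x ≼ x
≼-refl = ≤-refl , ≤-refl

≼-trans : ∀ {x y z} → x ≼ y → y ≼ z → x ≼ z
≼-trans (p , q) (p′ , q′) = ≤-trans p p′ , ≤-trans q q′

≼-respʳ : ∀ {x y z} → y ≡ z → x ≼ y → x ≼ z
≼-respʳ refl h = h

≼-respˡ : ∀ {x y z} → x ≡ y → x ≼ z → y ≼ z
≼-respˡ refl h = h

x≼x⊕y : ∀ x y → x ≼ x ⊕ y
x≼x⊕y x y = m≤m+n (re x) (re y) , m≤m+n (im x) (im y)

y≼x⊕y : ∀ x y → y ≼ x ⊕ y
y≼x⊕y x y = m≤n+m (re y) (re x) , m≤n+m (im y) (im x)

⊕-mono-≼ : ∀ {x x′ y y′} → x ≼ x′ → y ≼ y′ → x ⊕ y ≼ x′ ⊕ y′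
⊕-mono-≼ (p , q) (p′ , q′) = +-mono-≤ p p′ , +-mono-≤ q q′

⊗-monoʳ-≼ : ∀ w {x y} → x ≼ y → w ⊗ x ≼ w ⊗ y
⊗-monoʳ-≼ w (p , q) =
  +-mono-≤ (*-monoʳ-≤ (re w) p) (*-monoʳ-≤ 2 (*-monoʳ-≤ (im w) q)) ,
  +-mono-≤ (*-monoʳ-≤ (re w) q) (*-monoʳ-≤ (im w) p)

quadruple-mono-≼ : ∀ {x y} → x ≼ y → quadruple x ≼ quadruple y
quadruple-mono-≼ (p , q) = *-monoʳ-≤ 4 p , *-monoʳ-≤ 4 q

⊕-comm : ∀ x y → x ⊕ y ≡ y ⊕ x
⊕-comm x y = ℕ[√2]-ext (+-comm (re x) (re y)) (+-comm (im x) (im y))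

⊕-assoc : ∀ x y z → x ⊕ y ⊕ z ≡ x ⊕ (y ⊕ z)
⊕-assoc x y z = ℕ[√2]-ext (+-assoc (re x) (re y) (re z)) (+-assoc (im x) (im y) (im z))

x⊕[y⊕z]≡y⊕[x⊕z] : ∀ x y z → x ⊕ (y ⊕ z) ≡ y ⊕ (x ⊕ z)
x⊕[y⊕z]≡y⊕[x⊕z] x y z = ℕ[√2]-ext (exchange (re x) (re y) (re z)) (exchange (im x) (im y) (im z))
  where
  exchange : ∀ a b c → a + (b + c) ≡ b + (a + c)
  exchange = solve-∀

⊕-identityʳ : ∀ x → x ⊕ 𝟎 ≡ x
⊕-identityʳ x = ℕ[√2]-ext (+-identityʳ (re x)) (+-identityʳ (im x))

⊗-zeroʳ : ∀ w → w ⊗ 𝟎 ≡ 𝟎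
⊗-zeroʳ w = ℕ[√2]-ext (cong₂ _+_ (*-zeroʳ (re w)) (cong (2 *_) (*-zeroʳ (im w))))
                      (cong₂ _+_ (*-zeroʳ (re w)) (*-zeroʳ (im w)))

⊗-distribˡ-⊕ : ∀ w x y → w ⊗ (x ⊕ y) ≡ w ⊗ x ⊕ w ⊗ y
⊗-distribˡ-⊕ ⟨ w₁ , w₂ ⟩ ⟨ x₁ , x₂ ⟩ ⟨ y₁ , y₂ ⟩ =
  ℕ[√2]-ext (distrib-re w₁ w₂ x₁ x₂ y₁ y₂) (distrib-im w₁ w₂ x₁ x₂ y₁ y₂)
  where
  distrib-re : ∀ w₁ w₂ x₁ x₂ y₁ y₂ → w₁ * (x₁ + y₁) + 2 * (w₂ * (x₂ + y₂))
               ≡ (w₁ * x₁ + 2 * (w₂ * x₂)) + (w₁ * y₁ + 2 * (w₂ * y₂))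
  distrib-re = solve-∀
  distrib-im : ∀ w₁ w₂ x₁ x₂ y₁ y₂ → w₁ * (x₂ + y₂) + w₂ * (x₁ + y₁)
               ≡ (w₁ * x₂ + w₂ * x₁) + (w₁ * y₂ + w₂ * y₁)
  distrib-im = solve-∀

∑< : ℕ → (ℕ → ℕ[√2]) → ℕ[√2]
∑< zero f = 𝟎
∑< (suc n) f = ∑< n f ⊕ f n

∑<-cong : ∀ {f g} n → (∀ i → f i ≡ g i) → ∑< n f ≡ ∑< n g
∑<-cong zero eq = refl
∑<-cong (suc n) eq = cong₂ _⊕_ (∑<-cong n eq) (eq n)

∑<-mono-≼ : ∀ {f g} n → (∀ i → i < n → f i ≼ g i) → ∑< n f ≼ ∑< n g
∑<-mono-≼ zero le = ≼-refl
∑<-mono-≼ (suc n) le = ⊕-mono-≼ (∑<-mono-≼ n (λ i i<n → le i (m<n⇒m<1+n i<n))) (le n ≤-refl)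

∑<-mono-≼-surplus : ∀ {f g} t n i₀ → i₀ < n → (∀ i → i < n → f i ≼ g i) →
                    t ⊕ f i₀ ≼ g i₀ → t ⊕ ∑< n f ≼ ∑< n g
∑<-mono-≼-surplus {f} t (suc n) i₀ i₀<1+n le surplus with i₀ ≟ n
... | yes refl = ≼-respˡ (x⊕[y⊕z]≡y⊕[x⊕z] (∑< n f) t (f n))
                   (⊕-mono-≼ (∑<-mono-≼ n (λ i i<n → le i (m<n⇒m<1+n i<n))) surplus)
... | no i₀≢n = ≼-respˡ (⊕-assoc t (∑< n f) (f n))
                  (⊕-mono-≼ (∑<-mono-≼-surplus t n i₀ (≤∧≢⇒< (≤-pred i₀<1+n) i₀≢n)
                               (λ i i<n → le i (m<n⇒m<1+n i<n)) surplus)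
                            (le n ≤-refl))

∑<-monoˡ-≼ : ∀ f {m n} → m ≤ n → ∑< m f ≼ ∑< n f
∑<-monoˡ-≼ f {m} {zero} z≤n = ≼-refl
∑<-monoˡ-≼ f {m} {suc n} m≤1+n with m ≟ suc n
... | yes refl = ≼-refl
... | no m≢1+n = ≼-trans (∑<-monoˡ-≼ f (≤-pred (≤∧≢⇒< m≤1+n m≢1+n))) (x≼x⊕y (∑< n f) (f n))

term-≼-∑< : ∀ f {i n} → i < n → f i ≼ ∑< n f
term-≼-∑< f {i} {suc n} i<1+n with i ≟ n
... | yes refl = y≼x⊕y (∑< i f) (f i)
... | no i≢n = ≼-trans (term-≼-∑< f (≤∧≢⇒< (≤-pred i<1+n) i≢n)) (x≼x⊕y (∑< n f) (f n))

∑<-suc-head : ∀ f n → ∑< (suc n) f ≡ f 0 ⊕ ∑< n (λ i → f (suc i))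
∑<-suc-head f zero = ⊕-comm 𝟎 (f 0)
∑<-suc-head f (suc n) = trans (cong (_⊕ f (suc n)) (∑<-suc-head f n)) (⊕-assoc (f 0) _ _)

∑<-const : ∀ n v → ∑< n (λ _ → v) ≡ ⟨ n * re v , n * im v ⟩
∑<-const zero v = refl
∑<-const (suc n) v = trans (cong (_⊕ v) (∑<-const n v)) (⊕-comm _ v)

∑<-𝟎 : ∀ n → ∑< n (λ _ → 𝟎) ≡ 𝟎
∑<-𝟎 zero = refl
∑<-𝟎 (suc n) = cong (_⊕ 𝟎) (∑<-𝟎 n)

-- (p₀ − n′) + (p₁ − n′) ≤ 2 (p − n), written without subtraction.
record MeanBound (p₀ p₁ n p n′ : ℕ[√2]) : Set where
  constructor meanBound
  field
    bound : p₀ ⊕ p₁ ⊕ double n ≼ double p ⊕ double n′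

MeanBound-⊕ : ∀ {p₀ p₁ n p n′ q₀ q₁ m q m′} → MeanBound p₀ p₁ n p n′ → MeanBound q₀ q₁ m q m′ →
              MeanBound (p₀ ⊕ q₀) (p₁ ⊕ q₁) (n ⊕ m) (p ⊕ q) (n′ ⊕ m′)
MeanBound-⊕ {p₀} {p₁} {n} {p} {n′} {q₀} {q₁} {m} {q} {m′} (meanBound (le₁ , le₂)) (meanBound (le₁′ , le₂′)) =
  meanBound (add (re p₀) (re p₁) (re n) (re p) (re n′) (re q₀) (re q₁) (re m) (re q) (re m′) le₁ le₁′ ,
             add (im p₀) (im p₁) (im n) (im p) (im n′) (im q₀) (im q₁) (im m) (im q) (im m′) le₂ le₂′)
  where
  regroup : ∀ a b c a′ b′ c′ →
    a + a′ + (b + b′) + (c + c′ + (c + c′)) ≡ (a + b + (c + c)) + (a′ + b′ + (c′ + c′))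
  regroup = solve-∀
  add : ∀ a b c d e a′ b′ c′ d′ e′ → a + b + (c + c) ≤ d + d + (e + e) → a′ + b′ + (c′ + c′) ≤ d′ + d′ + (e′ + e′) →
        a + a′ + (b + b′) + (c + c′ + (c + c′)) ≤ d + d′ + (d + d′) + (e + e′ + (e + e′))
  add a b c d e a′ b′ c′ d′ e′ le le′ =
    subst₂ _≤_ (sym (regroup a b c a′ b′ c′)) (sym (regroup d d e d′ d′ e′)) (+-mono-≤ le le′)

MeanBound-⊗ : ∀ w {p₀ p₁ n p n′} → MeanBound p₀ p₁ n p n′ →
              MeanBound (w ⊗ p₀) (w ⊗ p₁) (w ⊗ n) (w ⊗ p) (w ⊗ n′)
MeanBound-⊗ w {p₀} {p₁} {n} {p} {n′} (meanBound le) =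
  meanBound (≼-respˡ (distrib p₀ p₁ n n) (≼-respʳ (distrib p p n′ n′) (⊗-monoʳ-≼ w le)))
  where
  distrib : ∀ a b c d → w ⊗ (a ⊕ b ⊕ (c ⊕ d)) ≡ w ⊗ a ⊕ w ⊗ b ⊕ (w ⊗ c ⊕ w ⊗ d)
  distrib a b c d = begin
    w ⊗ (a ⊕ b ⊕ (c ⊕ d))               ≡⟨ ⊗-distribˡ-⊕ w (a ⊕ b) (c ⊕ d) ⟩
    w ⊗ (a ⊕ b) ⊕ w ⊗ (c ⊕ d)           ≡⟨ cong₂ _⊕_ (⊗-distribˡ-⊕ w a b) (⊗-distribˡ-⊕ w c d) ⟩
    w ⊗ a ⊕ w ⊗ b ⊕ (w ⊗ c ⊕ w ⊗ d)     ∎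
    where open ≡-Reasoning

MeanBound-∑< : ∀ {f₀ f₁ g f h} n → (∀ i → MeanBound (f₀ i) (f₁ i) (g i) (f i) (h i)) →
               MeanBound (∑< n f₀) (∑< n f₁) (∑< n g) (∑< n f) (∑< n h)
MeanBound-∑< zero mb = meanBound ≼-refl
MeanBound-∑< (suc n) mb = MeanBound-⊕ (MeanBound-∑< n mb) (mb n)

MeanBound-descent : ∀ {t p₀ p₁ n p n′} → MeanBound p₀ p₁ n p n′ → t ⊕ n′ ≼ p₀ → t ⊕ n′ ≼ p₁ → t ⊕ n ≼ p
MeanBound-descent {t} {p₀} {p₁} {n} {p} {n′} (meanBound (le₁ , le₂)) (h₀₁ , h₀₂) (h₁₁ , h₁₂) =
  descent-ℕ (re t) (re n′) (re p₀) (re p₁) (re n) (re p) h₀₁ h₁₁ le₁ ,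
  descent-ℕ (im t) (im n′) (im p₀) (im p₁) (im n) (im p) h₀₂ h₁₂ le₂
  where
  descent-ℕ : ∀ t n′ p₀ p₁ n p → t + n′ ≤ p₀ → t + n′ ≤ p₁ → p₀ + p₁ + (n + n) ≤ p + p + (n′ + n′) → t + n ≤ p
  descent-ℕ t n′ p₀ p₁ n p h₀ h₁ le = *-cancelˡ-≤ 2 (+-cancelʳ-≤ (n′ + n′) (2 * (t + n)) (2 * p) (begin
    2 * (t + n) + (n′ + n′)         ≡⟨ regroup t n n′ ⟩
    (t + n′) + (t + n′) + (n + n)   ≤⟨ +-monoˡ-≤ (n + n) (+-mono-≤ h₀ h₁) ⟩
    p₀ + p₁ + (n + n)               ≤⟨ le ⟩
    p + p + (n′ + n′)               ≡⟨ cong (_+ (n′ + n′)) (p+p≡2*p p) ⟩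
    2 * p + (n′ + n′)               ∎))
    where
    open ≤-Reasoning
    regroup : ∀ t n n′ → 2 * (t + n) + (n′ + n′) ≡ (t + n′) + (t + n′) + (n + n)
    regroup = solve-∀
    p+p≡2*p : ∀ p → p + p ≡ 2 * p
    p+p≡2*p = solve-∀

MeanBound-increment : ∀ {g g₀ g₁ n n′} δ₀ δ₁ δ k₀ k₁ k → g₀ ≡ g → g₁ ≡ g → n′ ≡ n ⊕ δ →
  quadruple δ₀ ⊕ k₀ ⊕ (quadruple δ₁ ⊕ k₁) ≼ double k ⊕ double δ →
  MeanBound (quadruple (g₀ ⊕ δ₀) ⊕ k₀) (quadruple (g₁ ⊕ δ₁) ⊕ k₁) n (quadruple g ⊕ k) n′
MeanBound-increment {g} {n = n} δ₀ δ₁ δ k₀ k₁ k refl refl refl (le₁ , le₂) = meanBound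
  (increment (re g) (re n) (re δ₀) (re δ₁) (re δ) (re k₀) (re k₁) (re k) le₁ ,
   increment (im g) (im n) (im δ₀) (im δ₁) (im δ) (im k₀) (im k₁) (im k) le₂)
  where
  increment : ∀ g n δ₀ δ₁ δ k₀ k₁ k → 4 * δ₀ + k₀ + (4 * δ₁ + k₁) ≤ k + k + (δ + δ) →
    4 * (g + δ₀) + k₀ + (4 * (g + δ₁) + k₁) + (n + n) ≤ 4 * g + k + (4 * g + k) + (n + δ + (n + δ))
  increment g n δ₀ δ₁ δ k₀ k₁ k le = begin
    4 * (g + δ₀) + k₀ + (4 * (g + δ₁) + k₁) + (n + n) ≡⟨ lhs g n δ₀ δ₁ k₀ k₁ ⟩
    8 * g + (n + n) + (4 * δ₀ + k₀ + (4 * δ₁ + k₁))    ≤⟨ +-monoʳ-≤ (8 * g + (n + n)) le ⟩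
    8 * g + (n + n) + (k + k + (δ + δ))                ≡⟨ rhs g n δ k ⟩
    4 * g + k + (4 * g + k) + (n + δ + (n + δ))        ∎
    where
    open ≤-Reasoning
    lhs : ∀ g n δ₀ δ₁ k₀ k₁ → 4 * (g + δ₀) + k₀ + (4 * (g + δ₁) + k₁) + (n + n)
                              ≡ 8 * g + (n + n) + (4 * δ₀ + k₀ + (4 * δ₁ + k₁))
    lhs = solve-∀
    rhs : ∀ g n δ k → 8 * g + (n + n) + (k + k + (δ + δ)) ≡ 4 * g + k + (4 * g + k) + (n + δ + (n + δ))
    rhs = solve-∀

weight : Bool → Bool → ℕ[√2]
weight false _ = 𝟎
weight true true = ⟨ 1 , 0 ⟩
weight true false = ⟨ 1 , 1 ⟩

-- Colouring x: t and u say whether x − d and x − 1 − d are reached at level j, v whether x − 1 is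
-- reached at level j + 1. The check is tight for t ∧ ¬ u ∧ ¬ v, which is what forces μ = 2 + √2.
step-weights-bound : ∀ t u v colour →
  let r : Fin 2 → Bool
      r b = does (b ≟ᶠ colour) ∧ (t ∨ u)
  in quadruple (weight (r red) v) ⊕ double (weight t (r red)) ⊕ (quadruple (weight (r blue) v) ⊕ double (weight t (r blue)))
     ≼ double (double (weight u v)) ⊕ double (μ ⊗ weight t u)
step-weights-bound false false false red = ≼-by-computation
step-weights-bound false false false blue = ≼-by-computation
step-weights-bound false false true red = ≼-by-computation
step-weights-bound false false true blue = ≼-by-computation
step-weights-bound false true false red = ≼-by-computation
step-weights-bound false true false blue = ≼-by-computation
step-weights-bound false true true red = ≼-by-computation
step-weights-bound false true true blue = ≼-by-computation
step-weights-bound true false false red = ≼-by-computation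
step-weights-bound true false false blue = ≼-by-computation
step-weights-bound true false true red = ≼-by-computation
step-weights-bound true false true blue = ≼-by-computation
step-weights-bound true true false red = ≼-by-computation
step-weights-bound true true false blue = ≼-by-computation
step-weights-bound true true true red = ≼-by-computation
step-weights-bound true true true blue = ≼-by-computation

start-pending : ℕ → ℕ → ℕ[√2]
start-pending a x = double (weight (does (x ≤? a)) false)

start-weights-bound : ∀ x a colour v → (x ≡ a → v ≡ false) →
  let r : Fin 2 → Bool
      r b = does (x ≟ a) ∧ does (b ≟ᶠ colour)
  in quadruple (weight (r red) v) ⊕ start-pending a (suc x) ⊕ (quadruple (weight (r blue) v) ⊕ start-pending a (suc x))
     ≼ double (start-pending a x) ⊕ double 𝟎
start-weights-bound x a colour v first with <-cmp x a
... | tri< x<a x≢a _ rewrite dec-false (x ≟ a) x≢a | dec-true (suc x ≤? a) x<a | dec-true (x ≤? a) (<⇒≤ x<a) =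
  ≼-by-computation
... | tri> _ x≢a a<x rewrite dec-false (x ≟ a) x≢a | dec-false (suc x ≤? a) (<⇒≱ (m<n⇒m<1+n a<x))
                           | dec-false (x ≤? a) (<⇒≱ a<x) = ≼-by-computation
... | tri≈ _ refl _ rewrite dec-true (x ≟ x) refl | dec-false (suc x ≤? x) (<-irrefl refl) | dec-true (x ≤? x) ≤-refl
                          | first refl = at-a colour
  where
  at-a : ∀ colour → quadruple (weight (does (red ≟ᶠ colour)) false) ⊕ 𝟎 ⊕
                    (quadruple (weight (does (blue ≟ᶠ colour)) false) ⊕ 𝟎) ≼ double ⟨ 2 , 2 ⟩ ⊕ double 𝟎
  at-a red = ≼-by-computation
  at-a blue = ≼-by-computation

module Frame (a′ d′ : ℕ) (colour : Fin 2) where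
  a d : ℕ
  a = suc a′
  d = suc d′

  hasColour : Colouring → ℕ → Bool
  hasColour c y = does (c y ≟ᶠ colour)

  -- y is the last term of a (j+1)-term quasi-progression of diameter 1 in the colour,
  -- with first term a and low difference d.
  reaches : Colouring → ℕ → ℕ → Bool
  reaches c zero y = does (y ≟ a) ∧ hasColour c y
  reaches c (suc j) y = hasColour c y ∧ (reaches c j (y ∸ d) ∨ reaches c j (y ∸ suc d))

  -- Each reached point weighs 1, and √2 more if it starts a run, i.e. if y − 1 is not reached.
  cell : Colouring → ℕ → ℕ → ℕ[√2]
  cell c j y = weight (reaches c j y) (reaches c j (y ∸ 1))

  mass : Colouring → ℕ → ℕ → ℕ[√2]
  mass c j x = ∑< x (cell c j)

  -- With 1, …, x − 1 coloured, Φ⁺ is four times the mass reached so far plus the expected gain at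
  -- the next point x, a candidate at level j + 1 when x − 1 − d is reached at level j. Φ⁻ at level
  -- j + 1 charges μ for each unit of level-j mass whose successors are at most x.
  Φ⁺ : Colouring → ℕ → ℕ → ℕ[√2]
  Φ⁺ c zero x = quadruple (mass c zero x) ⊕ start-pending a x
  Φ⁺ c (suc j) x = quadruple (mass c (suc j) x) ⊕ double (weight (reaches c j (x ∸ suc d)) (reaches c (suc j) (x ∸ 1)))

  Φ⁻ : Colouring → ℕ → ℕ → ℕ[√2]
  Φ⁻ c zero x = 𝟎
  Φ⁻ c (suc j) x = μ ⊗ mass c j (x ∸ d)

  reaches-local : ∀ {c c′} j y → AgreeBelow (suc y) c c′ → reaches c j y ≡ reaches c′ j y
  reaches-local zero y agree = cong (λ b → does (y ≟ a) ∧ does (b ≟ᶠ colour)) (agree y ≤-refl)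
  reaches-local (suc j) y agree = cong₂ (λ b r → does (b ≟ᶠ colour) ∧ r) (agree y ≤-refl)
    (cong₂ _∨_ (reaches-local j (y ∸ d) (AgreeBelow-mono (s≤s (m∸n≤m y d)) agree))
               (reaches-local j (y ∸ suc d) (AgreeBelow-mono (s≤s (m∸n≤m y (suc d))) agree)))

  mass-local : ∀ {c c′} j x → AgreeBelow x c c′ → mass c j x ≡ mass c′ j x
  mass-local j zero agree = refl
  mass-local j (suc x) agree = cong₂ _⊕_ (mass-local j x (AgreeBelow-mono (n≤1+n x) agree))
    (cong₂ weight (reaches-local j x agree) (reaches-local j (x ∸ 1) (AgreeBelow-mono (s≤s (m∸n≤m x 1)) agree)))

  reaches-0 : ∀ c j → reaches c j 0 ≡ false
  reaches-0 c zero = refl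
  reaches-0 c (suc j) = trans (cong (λ r → hasColour c 0 ∧ (r ∨ r)) (reaches-0 c j)) (∧-zeroʳ _)

  cell-0 : ∀ c j → cell c j 0 ≡ 𝟎
  cell-0 c j = cong (λ r → weight r (reaches c j 0)) (reaches-0 c j)

  mass-shifted-suc : ∀ c j x → mass c j (suc x ∸ d) ≡ mass c j (x ∸ d) ⊕ cell c j (x ∸ d)
  mass-shifted-suc c j x with d′ <? x
  ... | yes d≤x = cong (mass c j) (+-∸-assoc 1 d≤x)
  ... | no x≤d′ = begin
    mass c j (suc x ∸ d)                  ≡⟨ cong (mass c j) (m≤n⇒m∸n≡0 (≮⇒≥ x≤d′)) ⟩
    𝟎                                     ≡⟨ cong (𝟎 ⊕_) (sym (cell-0 c j)) ⟩
    𝟎 ⊕ cell c j 0                        ≡⟨ cong (λ y → mass c j y ⊕ cell c j y) (sym x∸d≡0) ⟩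
    mass c j (x ∸ d) ⊕ cell c j (x ∸ d)   ∎
    where
    open ≡-Reasoning
    x∸d≡0 : x ∸ d ≡ 0
    x∸d≡0 = m≤n⇒m∸n≡0 (m≤n⇒m≤1+n (≮⇒≥ x≤d′))

  Φ-meanBound : ∀ c x′ j →
    let x = suc x′ in
    MeanBound (Φ⁺ (c [ x ≔ red ]) j (suc x)) (Φ⁺ (c [ x ≔ blue ]) j (suc x)) (Φ⁻ c j x) (Φ⁺ c j x) (Φ⁻ c j (suc x))
  Φ-meanBound c x′ zero =
    MeanBound-increment (cell (c [ x ≔ red ]) 0 x) (cell (c [ x ≔ blue ]) 0 x) 𝟎
                        (start-pending a (suc x)) (start-pending a (suc x)) (start-pending a x)
      (mass-local 0 x ([≔]-below c x red)) (mass-local 0 x ([≔]-below c x blue)) refl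
      (≼-respˡ (cong₂ _⊕_ (after red) (after blue)) (start-weights-bound x a colour (reaches c 0 x′) first-at-a))
    where
    x : ℕ
    x = suc x′
    after : ∀ b → quadruple (weight (does (x ≟ a) ∧ does (b ≟ᶠ colour)) (reaches c 0 x′)) ⊕ start-pending a (suc x)
                  ≡ quadruple (cell (c [ x ≔ b ]) 0 x) ⊕ start-pending a (suc x)
    after b = sym (cong (λ δ → quadruple δ ⊕ start-pending a (suc x))
      (cong₂ weight (cong (λ b′ → does (x ≟ a) ∧ does (b′ ≟ᶠ colour)) ([≔]-at c x b))
                    (reaches-local 0 x′ ([≔]-below c x b))))
    first-at-a : x ≡ a → reaches c 0 x′ ≡ false
    first-at-a x≡a rewrite dec-false (x′ ≟ a) (λ x′≡a → 1+n≢n (trans x≡a (sym x′≡a))) = refl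
  Φ-meanBound c x′ (suc j) =
    MeanBound-increment (cell (c [ x ≔ red ]) (suc j) x) (cell (c [ x ≔ blue ]) (suc j) x) (μ ⊗ cell c j (x ∸ d))
                        (pending red) (pending blue) (double (weight u v))
      (mass-local (suc j) x ([≔]-below c x red)) (mass-local (suc j) x ([≔]-below c x blue))
      (trans (cong (μ ⊗_) (mass-shifted-suc c j x)) (⊗-distribˡ-⊕ μ (mass c j (x ∸ d)) (cell c j (x ∸ d))))
      (≼-respˡ (cong₂ _⊕_ (after red) (after blue))
        (≼-respʳ (cong (λ w → double (double (weight u v)) ⊕ double (μ ⊗ w)) (sym cell-x∸d))
          (step-weights-bound t u v colour)))
    where
    x : ℕ
    x = suc x′
    t u v : Bool
    t = reaches c j (x ∸ d)
    u = reaches c j (x ∸ suc d)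
    v = reaches c (suc j) x′
    below-x∸d : ∀ b → AgreeBelow (suc (x ∸ d)) (c [ x ≔ b ]) c
    below-x∸d b = AgreeBelow-mono (s≤s (m∸n≤m x′ d′)) ([≔]-below c x b)
    below-x∸1+d : ∀ b → AgreeBelow (suc (x ∸ suc d)) (c [ x ≔ b ]) c
    below-x∸1+d b = AgreeBelow-mono (s≤s (m∸n≤m x′ d)) ([≔]-below c x b)
    reaches-x : ∀ b → reaches (c [ x ≔ b ]) (suc j) x ≡ does (b ≟ᶠ colour) ∧ (t ∨ u)
    reaches-x b = cong₂ (λ b′ r → does (b′ ≟ᶠ colour) ∧ r) ([≔]-at c x b)
      (cong₂ _∨_ (reaches-local j (x ∸ d) (below-x∸d b)) (reaches-local j (x ∸ suc d) (below-x∸1+d b)))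
    pending : Fin 2 → ℕ[√2]
    pending b = double (weight (reaches (c [ x ≔ b ]) j (x ∸ d)) (reaches (c [ x ≔ b ]) (suc j) x))
    after : ∀ b → quadruple (weight (does (b ≟ᶠ colour) ∧ (t ∨ u)) v) ⊕ double (weight t (does (b ≟ᶠ colour) ∧ (t ∨ u)))
                  ≡ quadruple (cell (c [ x ≔ b ]) (suc j) x) ⊕ pending b
    after b = sym (cong₂ _⊕_ (cong quadruple (cong₂ weight (reaches-x b) (reaches-local (suc j) x′ ([≔]-below c x b))))
                             (cong double (cong₂ weight (reaches-local j (x ∸ d) (below-x∸d b)) (reaches-x b))))
    cell-x∸d : cell c j (x ∸ d) ≡ weight t u
    cell-x∸d = cong (λ y → weight t (reaches c j y)) (trans (∸-+-assoc x d 1) (cong (x ∸_) (+-comm d 1)))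

∑frames : ℕ → ℕ → (ℕ → ℕ → Fin 2 → ℕ[√2]) → ℕ[√2]
∑frames N D F = ∑< N (λ i → ∑< D (λ e → F i e red ⊕ F i e blue))

∑frames-cong : ∀ N D {F G} → (∀ i e b → F i e b ≡ G i e b) → ∑frames N D F ≡ ∑frames N D G
∑frames-cong N D eq = ∑<-cong N (λ i → ∑<-cong D (λ e → cong₂ _⊕_ (eq i e red) (eq i e blue)))

∑frames-mono-≼-surplus : ∀ N D {F G} t i₀ e₀ b₀ → i₀ < N → e₀ < D → (∀ i e b → F i e b ≼ G i e b) →
                         t ⊕ F i₀ e₀ b₀ ≼ G i₀ e₀ b₀ → t ⊕ ∑frames N D F ≼ ∑frames N D G
∑frames-mono-≼-surplus N D {F} {G} t i₀ e₀ b₀ i₀<N e₀<D le surplus =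
  ∑<-mono-≼-surplus t N i₀ i₀<N (λ i _ → ∑<-mono-≼ D (λ e _ → ⊕-mono-≼ (le i e red) (le i e blue)))
    (∑<-mono-≼-surplus t D e₀ e₀<D (λ e _ → ⊕-mono-≼ (le i₀ e red) (le i₀ e blue)) (by-colour b₀ surplus))
  where
  by-colour : ∀ b₀ → t ⊕ F i₀ e₀ b₀ ≼ G i₀ e₀ b₀ → t ⊕ (F i₀ e₀ red ⊕ F i₀ e₀ blue) ≼ G i₀ e₀ red ⊕ G i₀ e₀ blue
  by-colour red s = ≼-respˡ (⊕-assoc t _ _) (⊕-mono-≼ s (le i₀ e₀ blue))
  by-colour blue s = ≼-respˡ (x⊕[y⊕z]≡y⊕[x⊕z] (F i₀ e₀ red) t (F i₀ e₀ blue)) (⊕-mono-≼ (le i₀ e₀ red) s)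

∑frames-const : ∀ N D v → ∑frames N D (λ _ _ _ → v) ≡ ⟨ N * (D * re (double v)) , N * (D * im (double v)) ⟩
∑frames-const N D v = trans (∑<-cong N (λ _ → ∑<-const D (double v))) (∑<-const N _)

MeanBound-∑frames : ∀ N D {F₀ F₁ G F H} → (∀ i e b → MeanBound (F₀ i e b) (F₁ i e b) (G i e b) (F i e b) (H i e b)) →
  MeanBound (∑frames N D F₀) (∑frames N D F₁) (∑frames N D G) (∑frames N D F) (∑frames N D H)
MeanBound-∑frames N D mb = MeanBound-∑< N (λ i → MeanBound-∑< D (λ e → MeanBound-⊕ (mb i e red) (mb i e blue)))

module _ {k : ℕ} (a : ℕ → ℕ) (d : ℕ)
         (steps : ∀ j → suc j < k → (a j + d ≤ a (suc j)) × (a (suc j) ≤ a j + d + 1)) where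

  quasiProgression-lower-bound : ∀ j → j < k → a 0 + j * d ≤ a j
  quasiProgression-lower-bound zero _ = ≤-reflexive (+-identityʳ (a 0))
  quasiProgression-lower-bound (suc j) 1+j<k = begin
    a 0 + (d + j * d) ≡⟨ regroup (a 0) d (j * d) ⟩
    a 0 + j * d + d   ≤⟨ +-monoˡ-≤ d (quasiProgression-lower-bound j (<⇒≤ 1+j<k)) ⟩
    a j + d           ≤⟨ proj₁ (steps j 1+j<k) ⟩
    a (suc j)         ∎
    where
    open ≤-Reasoning
    regroup : ∀ x y z → x + (y + z) ≡ x + z + y
    regroup = solve-∀

  quasiProgression-step : ∀ j → suc j < k → a (suc j) ∸ d ≡ a j ⊎ a (suc j) ∸ suc d ≡ a j
  quasiProgression-step j 1+j<k with a (suc j) ≟ a j + d | steps j 1+j<k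
  ... | yes next≡ | _ = inj₁ (trans (cong (_∸ d) next≡) (m+n∸n≡m (a j) d))
  ... | no next≢ | lower , upper = inj₂ (trans (cong (_∸ suc d) next≡) (m+n∸n≡m (a j) (suc d)))
    where
    next≡ : a (suc j) ≡ a j + suc d
    next≡ = trans (≤-antisym upper (≤-trans (≤-reflexive (+-comm (a j + d) 1)) (≤∧≢⇒< lower (≢-sym next≢))))
                  (trans (+-assoc (a j) d 1) (cong (a j +_) (+-comm d 1)))

monoQP-reaches : ∀ {k c} (a : ℕ → ℕ) a′ d′ → a 0 ≡ suc a′ →
  (∀ j → suc j < k → (a j + suc d′ ≤ a (suc j)) × (a (suc j) ≤ a j + suc d′ + 1)) →
  (∀ j → j < k → c (a j) ≡ c (a 0)) →
  ∀ j → j < k → Frame.reaches a′ d′ (c (a 0)) c j (a j) ≡ true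
monoQP-reaches {c = c} a a′ d′ a₀≡ steps mono zero _
  rewrite dec-true (a 0 ≟ suc a′) a₀≡ | dec-true (c (a 0) ≟ᶠ c (a 0)) refl = refl
monoQP-reaches {c = c} a a′ d′ a₀≡ steps mono (suc j) 1+j<k
  rewrite dec-true (c (a (suc j)) ≟ᶠ c (a 0)) (mono (suc j) 1+j<k) =
  from-previous (quasiProgression-step a (suc d′) steps j 1+j<k)
  where
  reaches-at : ℕ → Bool
  reaches-at = Frame.reaches a′ d′ (c (a 0)) c j
  previous : reaches-at (a j) ≡ true
  previous = monoQP-reaches a a′ d′ a₀≡ steps mono j (<⇒≤ 1+j<k)
  from-previous : a (suc j) ∸ suc d′ ≡ a j ⊎ a (suc j) ∸ suc (suc d′) ≡ a j →
                  reaches-at (a (suc j) ∸ suc d′) ∨ reaches-at (a (suc j) ∸ suc (suc d′)) ≡ true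
  from-previous (inj₁ by-d) rewrite by-d | previous = refl
  from-previous (inj₂ by-1+d) rewrite by-1+d | previous = ∨-zeroʳ _

progression-difference-bound : ∀ K N a₀ d .{{_ : NonZero K}} → 1 ≤ a₀ → a₀ + K * d ≤ N → d ≤ (N ∸ 1) / K
progression-difference-bound K N a₀ d 1≤a₀ fits = begin
  d               ≡⟨ m*n/n≡m d K ⟨
  d * K / K       ≤⟨ /-monoˡ-≤ K (m+n≤o⇒m≤o∸n (d * K) dK+1≤N) ⟩
  (N ∸ 1) / K     ∎
  where
  open ≤-Reasoning
  dK+1≤N : d * K + 1 ≤ N
  dK+1≤N = begin
    d * K + 1   ≡⟨ trans (+-comm (d * K) 1) (cong suc (*-comm d K)) ⟩
    1 + K * d   ≤⟨ +-monoˡ-≤ (K * d) 1≤a₀ ⟩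
    a₀ + K * d  ≤⟨ fits ⟩
    N           ∎

module Potential (K N : ℕ) .{{_ : NonZero K}} where
  D : ℕ
  D = (N ∸ 1) / K

  -- ω j = 4^j μ^(K − j), so that ω (j + 1) μ = 4 ω j and Φ⁻ at level j + 1 cancels against Φ⁺ at level j.
  ω : ℕ → ℕ[√2]
  ω j = ⟨ 4 ^ j , 0 ⟩ ⊗ μ^ (K ∸ j)

  ω-suc-μ : ∀ {j} → j < K → ∀ Y → ω (suc j) ⊗ (μ ⊗ Y) ≡ ω j ⊗ quadruple Y
  ω-suc-μ {j} j<K Y = trans (exchange (4 ^ j) (μ^ (K ∸ suc j)) Y)
                            (cong (λ W → (⟨ 4 ^ j , 0 ⟩ ⊗ W) ⊗ quadruple Y) (cong μ^ (sym (+-∸-assoc 1 j<K))))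
    where
    exchange : ∀ p W Y → (⟨ 4 * p , 0 ⟩ ⊗ W) ⊗ (μ ⊗ Y) ≡ (⟨ p , 0 ⟩ ⊗ (μ ⊗ W)) ⊗ quadruple Y
    exchange p ⟨ w₁ , w₂ ⟩ ⟨ y₁ , y₂ ⟩ = ℕ[√2]-ext (exchange-re p w₁ w₂ y₁ y₂) (exchange-im p w₁ w₂ y₁ y₂)
      where
      exchange-re : ∀ p w₁ w₂ y₁ y₂ →
        (4 * p * w₁ + 2 * (0 * w₂)) * (2 * y₁ + 2 * (1 * y₂)) + 2 * ((4 * p * w₂ + 0 * w₁) * (2 * y₂ + 1 * y₁))
        ≡ (p * (2 * w₁ + 2 * (1 * w₂)) + 2 * (0 * (2 * w₂ + 1 * w₁))) * (4 * y₁)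
          + 2 * ((p * (2 * w₂ + 1 * w₁) + 0 * (2 * w₁ + 2 * (1 * w₂))) * (4 * y₂))
      exchange-re = solve-∀
      exchange-im : ∀ p w₁ w₂ y₁ y₂ →
        (4 * p * w₁ + 2 * (0 * w₂)) * (2 * y₂ + 1 * y₁) + (4 * p * w₂ + 0 * w₁) * (2 * y₁ + 2 * (1 * y₂))
        ≡ (p * (2 * w₁ + 2 * (1 * w₂)) + 2 * (0 * (2 * w₂ + 1 * w₁))) * (4 * y₂)
          + (p * (2 * w₂ + 1 * w₁) + 0 * (2 * w₁ + 2 * (1 * w₂))) * (4 * y₁)
      exchange-im = solve-∀

  frameΦ⁺ frameΦ⁻ : ℕ → ℕ → Fin 2 → Colouring → ℕ → ℕ[√2]
  frameΦ⁺ i e b c x = ∑< (suc K) (λ j → ω j ⊗ Frame.Φ⁺ i e b c j x)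
  frameΦ⁻ i e b c x = ∑< (suc K) (λ j → ω j ⊗ Frame.Φ⁻ i e b c j x)

  Φ⁺-total Φ⁻-total : Colouring → ℕ → ℕ[√2]
  Φ⁺-total c x = ∑frames N D (λ i e b → frameΦ⁺ i e b c x)
  Φ⁻-total c x = ∑frames N D (λ i e b → frameΦ⁻ i e b c x)

  Φ-total-meanBound : ∀ c x′ →
    let x = suc x′ in
    MeanBound (Φ⁺-total (c [ x ≔ red ]) (suc x)) (Φ⁺-total (c [ x ≔ blue ]) (suc x))
              (Φ⁻-total c x) (Φ⁺-total c x) (Φ⁻-total c (suc x))
  Φ-total-meanBound c x′ = MeanBound-∑frames N D (λ i e b →
    MeanBound-∑< (suc K) (λ j → MeanBound-⊗ (ω j) (Frame.Φ-meanBound i e b c x′ j)))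

  Φ⁻-total-recolour : ∀ c x′ b → Φ⁻-total (c [ suc x′ ≔ b ]) (suc (suc x′)) ≡ Φ⁻-total c (suc (suc x′))
  Φ⁻-total-recolour c x′ b = ∑frames-cong N D (λ i e b′ → ∑<-cong (suc K) (λ j → cong (ω j ⊗_) (recolour i e b′ j)))
    where
    recolour : ∀ i e b′ j → Frame.Φ⁻ i e b′ (c [ suc x′ ≔ b ]) j (suc (suc x′)) ≡ Frame.Φ⁻ i e b′ c j (suc (suc x′))
    recolour i e b′ zero = refl
    recolour i e b′ (suc j) = cong (μ ⊗_) (Frame.mass-local i e b′ j (suc x′ ∸ e)
      (AgreeBelow-mono (m∸n≤m (suc x′) e) ([≔]-below c (suc x′) b)))

  target : ℕ[√2]
  target = ω K ⊗ ⟨ 4 , 4 ⟩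

  Invariant : ℕ → Set
  Invariant x = ∀ c → target ⊕ Φ⁻-total c x ≼ Φ⁺-total c x

  invariant-step : ∀ x′ → Invariant (suc (suc x′)) → Invariant (suc x′)
  invariant-step x′ inv c = MeanBound-descent (Φ-total-meanBound c x′) (after red) (after blue)
    where
    after : ∀ b → target ⊕ Φ⁻-total c (suc (suc x′)) ≼ Φ⁺-total (c [ suc x′ ≔ b ]) (suc (suc x′))
    after b = ≼-respˡ (cong (target ⊕_) (Φ⁻-total-recolour c x′ b)) (inv (c [ suc x′ ≔ b ]))

  invariant-downward : ∀ m x → Invariant (suc (m + x)) → Invariant (suc x)
  invariant-downward zero x inv = inv
  invariant-downward (suc m) x inv =
    invariant-step x (invariant-downward m (suc x) (subst Invariant (cong suc (sym (+-suc m x))) inv))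

  module _ (i e : ℕ) (b : Fin 2) (c : Colouring) where
    open Frame i e b

    quadruple-mass-≼-Φ⁺ : ∀ j x → quadruple (mass c j x) ≼ Φ⁺ c j x
    quadruple-mass-≼-Φ⁺ zero x = x≼x⊕y _ _
    quadruple-mass-≼-Φ⁺ (suc j) x = x≼x⊕y _ _

    frameΦ⁻-≼-lower-levels : ∀ x → frameΦ⁻ i e b c x ≼ ∑< K (λ j → ω j ⊗ Φ⁺ c j x)
    frameΦ⁻-≼-lower-levels x = ≼-respˡ (sym drop-level-0) (∑<-mono-≼ K level-j+1≼level-j)
      where
      drop-level-0 : frameΦ⁻ i e b c x ≡ ∑< K (λ j → ω (suc j) ⊗ Φ⁻ c (suc j) x)
      drop-level-0 = trans (∑<-suc-head (λ j → ω j ⊗ Φ⁻ c j x) K)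
                           (cong (_⊕ ∑< K (λ j → ω (suc j) ⊗ Φ⁻ c (suc j) x)) (⊗-zeroʳ (ω 0)))
      level-j+1≼level-j : ∀ j → j < K → ω (suc j) ⊗ Φ⁻ c (suc j) x ≼ ω j ⊗ Φ⁺ c j x
      level-j+1≼level-j j j<K = ≼-respˡ (sym (ω-suc-μ j<K (mass c j (x ∸ d))))
        (⊗-monoʳ-≼ (ω j) (≼-trans (quadruple-mono-≼ (∑<-monoˡ-≼ (cell c j) (m∸n≤m x d))) (quadruple-mass-≼-Φ⁺ j x)))

    frameΦ⁻-≼-frameΦ⁺ : ∀ x → frameΦ⁻ i e b c x ≼ frameΦ⁺ i e b c x
    frameΦ⁻-≼-frameΦ⁺ x = ≼-trans (frameΦ⁻-≼-lower-levels x) (x≼x⊕y _ _)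

    run-start : ∀ j y → reaches c j y ≡ true → ∃[ y′ ] y′ ≤ y × cell c j y′ ≡ ⟨ 1 , 1 ⟩
    run-start j zero reached with () ← trans (sym reached) (reaches-0 c j)
    run-start j (suc y) reached with reaches c j y in reached-y
    ... | true = let (y′ , y′≤y , start) = run-start j y reached-y in y′ , m≤n⇒m≤1+n y′≤y , start
    ... | false = suc y , ≤-refl , cong₂ weight reached reached-y

    target-≼-frame : ∀ x y → y < x → reaches c K y ≡ true → target ⊕ frameΦ⁻ i e b c x ≼ frameΦ⁺ i e b c x
    target-≼-frame x y y<x reached =
      ≼-respʳ (⊕-comm (ω K ⊗ Φ⁺ c K x) (∑< K (λ j → ω j ⊗ Φ⁺ c j x)))
        (⊕-mono-≼ (⊗-monoʳ-≼ (ω K) (≼-trans (quadruple-mono-≼ one-run) (quadruple-mass-≼-Φ⁺ K x)))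
                  (frameΦ⁻-≼-lower-levels x))
      where
      one-run : ⟨ 1 , 1 ⟩ ≼ mass c K x
      one-run with run-start K y reached
      ... | y′ , y′≤y , start = ≼-respˡ start (term-≼-∑< (cell c K) (≤-<-trans y′≤y y<x))

    frameΦ⁺-at-1 : frameΦ⁺ i e b c 1 ≡ ω 0 ⊗ ⟨ 2 , 2 ⟩
    frameΦ⁺-at-1 = begin
      frameΦ⁺ i e b c 1                                       ≡⟨ ∑<-suc-head (λ j → ω j ⊗ Φ⁺ c j 1) K ⟩
      ω 0 ⊗ ⟨ 2 , 2 ⟩ ⊕ ∑< K (λ j → ω (suc j) ⊗ Φ⁺ c (suc j) 1) ≡⟨ cong (ω 0 ⊗ ⟨ 2 , 2 ⟩ ⊕_) (∑<-cong K higher-levels-vanish) ⟩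
      ω 0 ⊗ ⟨ 2 , 2 ⟩ ⊕ ∑< K (λ _ → 𝟎)                        ≡⟨ cong (ω 0 ⊗ ⟨ 2 , 2 ⟩ ⊕_) (∑<-𝟎 K) ⟩
      ω 0 ⊗ ⟨ 2 , 2 ⟩ ⊕ 𝟎                                     ≡⟨ ⊕-identityʳ _ ⟩
      ω 0 ⊗ ⟨ 2 , 2 ⟩                                         ∎
      where
      open ≡-Reasoning
      higher-levels-vanish : ∀ j → ω (suc j) ⊗ Φ⁺ c (suc j) 1 ≡ 𝟎
      higher-levels-vanish j rewrite cell-0 c (suc j) | reaches-0 c j = ⊗-zeroʳ (ω (suc j))

  invariant-at-end : QPProperty 1 2 (suc K) N → Invariant (suc N)
  invariant-at-end has-QP c with has-QP c
  ... | a , zero , () , _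
  ... | a , suc d′ , _ , in-range , steps , mono =
    ∑frames-mono-≼-surplus N D target a′ d′ (c (a 0)) a′<N d′<D
      (λ i e b → frameΦ⁻-≼-frameΦ⁺ i e b c (suc N))
      (target-≼-frame a′ d′ (c (a 0)) c (suc N) (a K) (s≤s (proj₂ (in-range K ≤-refl)))
        (monoQP-reaches a a′ d′ a₀≡ steps (λ j j<k → mono j 0 j<k (s≤s z≤n)) K ≤-refl))
    where
    1≤a₀ : 1 ≤ a 0
    1≤a₀ = proj₁ (in-range 0 (s≤s z≤n))
    a′ : ℕ
    a′ = pred (a 0)
    a₀≡ : a 0 ≡ suc a′
    a₀≡ = sym (suc-pred (a 0) {{>-nonZero 1≤a₀}})
    fits : a 0 + K * suc d′ ≤ N
    fits = ≤-trans (quasiProgression-lower-bound a (suc d′) steps K ≤-refl) (proj₂ (in-range K ≤-refl))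
    a′<N : a′ < N
    a′<N = ≤-trans (≤-reflexive (sym a₀≡)) (≤-trans (m≤m+n (a 0) (K * suc d′)) fits)
    d′<D : d′ < D
    d′<D = progression-difference-bound K N (a 0) (suc d′) 1≤a₀ fits

  target-≼-start : QPProperty 1 2 (suc K) N → target ≼ ∑frames N D (λ _ _ _ → ω 0 ⊗ ⟨ 2 , 2 ⟩)
  target-≼-start has-QP =
    ≼-trans (x≼x⊕y target (Φ⁻-total all-red 1))
      (≼-respʳ (∑frames-cong N D (λ i e b → frameΦ⁺-at-1 i e b all-red))
        (invariant-downward N 0 (subst Invariant (cong suc (sym (+-identityʳ N))) (invariant-at-end has-QP)) all-red))
    where
    all-red : Colouring
    all-red _ = red

  count-bound : QPProperty 1 2 (suc K) N → 4 ^ K ≤ N * D * (re (μ^ K) + im (μ^ K))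
  count-bound has-QP = *-cancelˡ-≤ 4 (begin
    4 * 4 ^ K                   ≡⟨ im-target ⟨
    im target                   ≤⟨ _≼_.im-≤ (target-≼-start has-QP) ⟩
    im (∑frames N D (λ _ _ _ → ω 0 ⊗ ⟨ 2 , 2 ⟩))  ≡⟨ cong im (∑frames-const N D (ω 0 ⊗ ⟨ 2 , 2 ⟩)) ⟩
    N * (D * im (double (ω 0 ⊗ ⟨ 2 , 2 ⟩)))         ≡⟨ im-start N D (re (μ^ K)) (im (μ^ K)) ⟩
    4 * (N * D * (re (μ^ K) + im (μ^ K)))          ∎)
    where
    open ≤-Reasoning
    im-target : im target ≡ 4 * 4 ^ K
    im-target rewrite n∸n≡0 K = im-4^K⊗4 (4 ^ K)
      where
      im-4^K⊗4 : ∀ p → (p * 1 + 2 * (0 * 0)) * 4 + (p * 0 + 0 * 1) * 4 ≡ 4 * p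
      im-4^K⊗4 = solve-∀
    im-start : ∀ N D P Q → N * (D * ((1 * P + 2 * (0 * Q)) * 2 + (1 * Q + 0 * P) * 2 + ((1 * P + 2 * (0 * Q)) * 2 + (1 * Q + 0 * P) * 2)))
                           ≡ 4 * (N * D * (P + Q))
    im-start = solve-∀

BetaPowGe : ℕ → ℕ → Set
BetaPowGe k N = let A = proj₁ (betaSqPow k); B = proj₂ (betaSqPow k); M = N * N in
  (M ≤ A) × (2 * (B * B) ≤ (A ∸ M) * (A ∸ M))

≡-by-substitution : ∀ {l r u v} c → l + c * v ≡ r + c * u → u ≡ v → l ≡ r
≡-by-substitution {l} {r} {u} c eq refl = +-cancelʳ-≡ (c * u) l r eq

-- For A − B√2 = (4 − 2√2)^(K+1) and P + Q√2 = μ^K these say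
-- (A − B√2)(P + Q√2) = (4 − 2√2) 4^K and P² − 2Q² = 2^K.
betaSqPow-μ^-identities : ∀ K →
  let A = proj₁ (betaSqPow (suc K)); B = proj₂ (betaSqPow (suc K)); P = re (μ^ K); Q = im (μ^ K) in
  (A * P ≡ 4 * 4 ^ K + 2 * (B * Q)) × (B * P ≡ A * Q + 2 * 4 ^ K) × (P * P ≡ 2 * (Q * Q) + 2 ^ K)
betaSqPow-μ^-identities zero = refl , refl , refl
betaSqPow-μ^-identities (suc K) with betaSqPow-μ^-identities K
... | e₁ , e₂ , e₃ =
  ≡-by-substitution 4 (poly₁ A B P Q (4 ^ K)) e₁ ,
  ≡-by-substitution 4 (poly₂ A B P Q (4 ^ K)) e₂ ,
  ≡-by-substitution 2 (poly₃ P Q (2 ^ K)) e₃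
  where
  A = proj₁ (betaSqPow (suc K))
  B = proj₂ (betaSqPow (suc K))
  P = re (μ^ K)
  Q = im (μ^ K)
  poly₁ : ∀ A B P Q F → (4 * A + 4 * B) * (2 * P + 2 * (1 * Q)) + 4 * (4 * F + 2 * (B * Q))
                        ≡ 4 * (4 * F) + 2 * ((2 * A + 4 * B) * (2 * Q + 1 * P)) + 4 * (A * P)
  poly₁ = solve-∀
  poly₂ : ∀ A B P Q F → (2 * A + 4 * B) * (2 * P + 2 * (1 * Q)) + 4 * (A * Q + 2 * F)
                        ≡ (4 * A + 4 * B) * (2 * Q + 1 * P) + 2 * (4 * F) + 4 * (B * P)
  poly₂ = solve-∀
  poly₃ : ∀ P Q T → (2 * P + 2 * (1 * Q)) * (2 * P + 2 * (1 * Q)) + 2 * (2 * (Q * Q) + T)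
                    ≡ 2 * ((2 * Q + 1 * P) * (2 * Q + 1 * P)) + 2 * T + 2 * (P * P)
  poly₃ = solve-∀

-- X ≥ √2 B and √2 S > R give X S > B R; squaring keeps everything in ℕ.
√2-comparison : ∀ {B X S R T} → 2 * (B * B) ≤ X * X → 2 * (S * S) ≡ R * R + T → 1 ≤ T → 1 ≤ B → B * R < X * S
√2-comparison {B} {X} {S} {R} {T} 2B²≤X² 2S²≡R²+T 1≤T 1≤B with B * R <? X * S
... | yes BR<XS = BR<XS
... | no BR≮XS = ⊥-elim (<⇒≱ squares (*-mono-≤ (≮⇒≥ BR≮XS) (≮⇒≥ BR≮XS)))
  where
  open ≤-Reasoning
  squares : (B * R) * (B * R) < (X * S) * (X * S)
  squares = begin-strict
    (B * R) * (B * R)          ≡⟨ regroup₁ B R ⟩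
    B * B * (R * R) + 0        <⟨ +-monoʳ-< (B * B * (R * R)) (*-mono-≤ (*-mono-≤ 1≤B 1≤B) 1≤T) ⟩
    B * B * (R * R) + B * B * T ≡⟨ *-distribˡ-+ (B * B) (R * R) T ⟨
    B * B * (R * R + T)        ≡⟨ cong (B * B *_) 2S²≡R²+T ⟨
    B * B * (2 * (S * S))      ≡⟨ regroup₂ B S ⟩
    2 * (B * B) * (S * S)      ≤⟨ *-monoˡ-≤ (S * S) 2B²≤X² ⟩
    X * X * (S * S)            ≡⟨ regroup₃ X S ⟩
    (X * S) * (X * S)          ∎
    where
    regroup₁ : ∀ B R → (B * R) * (B * R) ≡ B * B * (R * R) + 0
    regroup₁ = solve-∀
    regroup₂ : ∀ B S → B * B * (2 * (S * S)) ≡ 2 * (B * B) * (S * S)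
    regroup₂ = solve-∀
    regroup₃ : ∀ X S → X * X * (S * S) ≡ (X * S) * (X * S)
    regroup₃ = solve-∀

-- M ≤ A − B√2 forces M (P + Q) < 2F, via A (P + Q) = 2F + B (P + 2Q) and √2 (P + Q) > P + 2Q.
below-βpow⇒bound : ∀ {A B P Q F T M} → A * P ≡ 4 * F + 2 * (B * Q) → B * P ≡ A * Q + 2 * F → P * P ≡ 2 * (Q * Q) + T →
                   1 ≤ T → 1 ≤ F → M ≤ A → 2 * (B * B) ≤ (A ∸ M) * (A ∸ M) → M * (P + Q) < 2 * F
below-βpow⇒bound {A} {B} {P} {Q} {F} {T} {M} e₁ e₂ e₃ 1≤T 1≤F M≤A 2B²≤X² =
  +-cancelʳ-< (X * (P + Q)) (M * (P + Q)) (2 * F) (begin-strict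
    M * (P + Q) + X * (P + Q)  ≡⟨ *-distribʳ-+ (P + Q) M X ⟨
    (M + X) * (P + Q)          ≡⟨ cong (_* (P + Q)) (m+[n∸m]≡n M≤A) ⟩
    A * (P + Q)                ≡⟨ A[P+Q] ⟩
    2 * F + B * (P + 2 * Q)    <⟨ +-monoʳ-< (2 * F) (√2-comparison {X = X} {S = P + Q} 2B²≤X² 2[P+Q]² 1≤T 1≤B) ⟩
    2 * F + X * (P + Q)        ∎)
  where
  open ≤-Reasoning
  X : ℕ
  X = A ∸ M
  A[P+Q] : A * (P + Q) ≡ 2 * F + B * (P + 2 * Q)
  A[P+Q] = +-cancelʳ-≡ (2 * F) (A * (P + Q)) (2 * F + B * (P + 2 * Q)) (begin-equality
    A * (P + Q) + 2 * F              ≡⟨ regroup₁ A P Q F ⟩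
    A * P + (A * Q + 2 * F)          ≡⟨ cong₂ _+_ e₁ (sym e₂) ⟩
    4 * F + 2 * (B * Q) + B * P      ≡⟨ regroup₂ F B Q P ⟩
    2 * F + B * (P + 2 * Q) + 2 * F  ∎)
    where
    regroup₁ : ∀ A P Q F → A * (P + Q) + 2 * F ≡ A * P + (A * Q + 2 * F)
    regroup₁ = solve-∀
    regroup₂ : ∀ F B Q P → 4 * F + 2 * (B * Q) + B * P ≡ 2 * F + B * (P + 2 * Q) + 2 * F
    regroup₂ = solve-∀
  2[P+Q]² : 2 * ((P + Q) * (P + Q)) ≡ (P + 2 * Q) * (P + 2 * Q) + T
  2[P+Q]² = ≡-by-substitution 1 (poly P Q T) e₃
    where
    poly : ∀ P Q T → 2 * ((P + Q) * (P + Q)) + 1 * (2 * (Q * Q) + T) ≡ (P + 2 * Q) * (P + 2 * Q) + T + 1 * (P * P)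
    poly = solve-∀
  1≤B : 1 ≤ B
  1≤B = n≢0⇒n>0 B≢0
    where
    B≢0 : B ≢ 0
    B≢0 refl = <⇒≱ (*-monoʳ-≤ 2 1≤F) (m≤n⇒m≤1+n (≤-trans (m≤n+m (2 * F) (A * Q)) (≤-reflexive (sym e₂))))

frames-too-few-k≥3 : ∀ K′ {F S N D} → (2 + K′) * D ≤ N ∸ 1 → F ≤ N * D * S → N * N * S < 2 * F → ⊥
frames-too-few-k≥3 K′ {F} {S} {N} {D} KD≤N-1 F≤NDS NNS<2F = <-irrefl refl (begin-strict
  K * F              ≤⟨ *-monoʳ-≤ K F≤NDS ⟩
  K * (N * D * S)    ≡⟨ regroup K N D S ⟩
  N * (K * D) * S    ≤⟨ *-monoˡ-≤ S (*-monoʳ-≤ N (≤-trans KD≤N-1 (m∸n≤m N 1))) ⟩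
  N * N * S          <⟨ NNS<2F ⟩
  2 * F              ≤⟨ *-monoˡ-≤ F (m≤m+n 2 K′) ⟩
  K * F              ∎)
  where
  open ≤-Reasoning
  K : ℕ
  K = 2 + K′
  regroup : ∀ K N D S → K * (N * D * S) ≡ N * (K * D) * S
  regroup = solve-∀

frames-too-few-k=2 : ∀ {N D} → D ≤ N ∸ 1 → 4 ≤ N * D * 3 → N * N * 3 < 8 → ⊥
frames-too-few-k=2 {zero} _ () _
frames-too-few-k=2 {suc zero} {zero} _ () _
frames-too-few-k=2 {suc (suc n)} _ _ NN3<8 =
  <⇒≱ NN3<8 (≤-trans (m≤m+n 8 4) (*-monoˡ-≤ 3 (*-mono-≤ 2≤N 2≤N)))
  where
  2≤N : 2 ≤ suc (suc n)
  2≤N = s≤s (s≤s z≤n)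

BetaPowGe⇒N²-bound : ∀ K N → BetaPowGe (suc K) N → N * N * (re (μ^ K) + im (μ^ K)) < 2 * 4 ^ K
BetaPowGe⇒N²-bound K N (M≤A , below) with betaSqPow-μ^-identities K
... | e₁ , e₂ , e₃ = below-βpow⇒bound {B = proj₂ (betaSqPow (suc K))} {M = N * N} e₁ e₂ e₃ (m^n>0 2 K) (m^n>0 4 K) M≤A below

differences-fit : ∀ K N .{{_ : NonZero K}} → K * ((N ∸ 1) / K) ≤ N ∸ 1
differences-fit K N = ≤-trans (≤-reflexive (*-comm K ((N ∸ 1) / K))) (m/n*n≤m (N ∸ 1) K)

QPProperty⇒¬BetaPowGe : ∀ K′ N → QPProperty 1 2 (2 + K′) N → ¬ BetaPowGe (2 + K′) N
QPProperty⇒¬BetaPowGe zero N has-QP ge =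
  frames-too-few-k=2 {N} (m/n≤m (N ∸ 1) 1) (Potential.count-bound 1 N has-QP) (BetaPowGe⇒N²-bound 1 N ge)
QPProperty⇒¬BetaPowGe (suc K″) N has-QP ge =
  frames-too-few-k≥3 K″ {N = N} {D = (N ∸ 1) / K} (differences-fit K N) (Potential.count-bound K N has-QP)
                     (BetaPowGe⇒N²-bound K N ge)
  where
  K : ℕ
  K = 2 + K″

BetaPowLt-by-refutation : ∀ k N → ¬ BetaPowGe k N → BetaPowLt k N
BetaPowLt-by-refutation k N ¬ge = by-cases (A <? N * N) ((A ∸ N * N) * (A ∸ N * N) <? 2 * (B * B))
  where
  A B : ℕ
  A = proj₁ (betaSqPow k)
  B = proj₂ (betaSqPow k)
  by-cases : Dec (A < N * N) → Dec ((A ∸ N * N) * (A ∸ N * N) < 2 * (B * B)) → BetaPowLt k N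
  by-cases (yes A<M) _ = inj₁ A<M
  by-cases (no _) (yes close) = inj₂ close
  by-cases (no A≮M) (no far) = ⊥-elim (¬ge (≮⇒≥ A≮M , ≮⇒≥ far))

mainTheorem2 : (k : ℕ) → 2 ≤ k → (N : ℕ) → IsQ 1 2 k N → BetaPowLt k N
mainTheorem2 (suc (suc K′)) (s≤s (s≤s z≤n)) N (_ , has-QP , _) =
  BetaPowLt-by-refutation (2 + K′) N (QPProperty⇒¬BetaPowGe K′ N has-QP)
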